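{- Let $G=(V,E;w)$ be a connected normalized graph with $k$ vertices, let $\delta\ge 0$, let $h$ be an integer with $2\le h<k$, and let $S$ be an $h$-way split of $G$ with density at most $(1+\delta)/k$. Then the density of a minimum-weight $(h+1)$-way split of $G$ is at most $$\frac{1+\delta}{k}+\frac{1-\delta}{hk}.$$
   Context: $G$ has positive edge weights $w:E\to\mathbb{R}^+$; $w(E')=\sum_{e\in E'}w(e)$; $G$ is normalized if $w(E)=1$. An edge set $S$ is an $h$-way split of $G$ if removing it increases the number of connected components by exactly $h-1$; its density is $w(S)/(h-1)$. -}

module Defs where

open import Data.Nat as ℕ using (ℕ; zero; suc)
open import Data.Fin using (Fin; zero; suc)
open import Data.Fin.Subset using (Subset; _∈_; _∉_; ⊥; ⊤)
open import Data.Fin.Subset.Properties using (_∈?_)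
open import Data.Product using (Σ; ∃; _×_; _,_)
open import Data.Sum using (_⊎_)
open import Relation.Nullary using (¬_; yes; no)
open import Relation.Binary.PropositionalEquality using (_≡_; _≢_)
open import Relation.Binary.Structures using (IsTotalOrder)
open import Relation.Binary.Construct.Closure.ReflexiveTransitive using (Star)
open import Algebra.Structures using (IsCommutativeRing)
open import Function.Definitions using (Surjective)
open import Function.Bundles using (_⇔_)

-- Ordered fields (the reals are one; the weights live in an arbitrary
-- ordered field, so the statement covers real weights).

record OrderedField : Set₁ where
  infixl 7 _*_
  infixl 6 _+_
  infix  8 -_
  infix  9 _⁻¹
  infix  4 _≤_ _<_
  field
    Carrier : Set
    _+_ _*_ : Carrier → Carrier → Carrier
    -_ _⁻¹  : Carrier → Carrier
    0# 1#   : Carrier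
    _≤_     : Carrier → Carrier → Set
    isCommutativeRing : IsCommutativeRing _≡_ _+_ _*_ -_ 0# 1#
    ≤-isTotalOrder    : IsTotalOrder _≡_ _≤_
    0≢1               : 0# ≢ 1#
    ⁻¹-inverse        : ∀ x → x ≢ 0# → x * (x ⁻¹) ≡ 1#
    +-monoˡ-≤         : ∀ {x y} z → x ≤ y → x + z ≤ y + z
    *-nonneg          : ∀ {x y} → 0# ≤ x → 0# ≤ y → 0# ≤ x * y

  _<_ : Carrier → Carrier → Set
  x < y = x ≤ y × x ≢ y

  _-_ : Carrier → Carrier → Carrier
  x - y = x + (- y)

  fromℕ : ℕ → Carrier
  fromℕ zero    = 0#
  fromℕ (suc n) = 1# + fromℕ n

  _/ℕ_ : Carrier → ℕ → Carrier
  x /ℕ n = x * (fromℕ n) ⁻¹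

  sumF : ∀ n → (Fin n → Carrier) → Carrier
  sumF zero    f = 0#
  sumF (suc n) f = f zero + sumF n (λ i → f (suc i))

record WGraph (F : OrderedField) (k m : ℕ) : Set where
  open OrderedField F
  field
    src dst  : Fin m → Fin k
    w        : Fin m → Carrier
    w-pos    : ∀ e → 0# < w e
    no-loop  : ∀ e → src e ≢ dst e
    no-multi : ∀ e e′ → (src e ≡ src e′ × dst e ≡ dst e′)
                        ⊎ (src e ≡ dst e′ × dst e ≡ src e′) → e ≡ e′

module _ {F : OrderedField} {k m : ℕ} (G : WGraph F k m) where
  open OrderedField F
  open WGraph G

  weight : Subset m → Carrier
  weight S = sumF m (λ e → wIf (e ∈? S) e)
    where
    wIf : ∀ {P : Set} → Relation.Nullary.Dec P → Fin m → Carrier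
    wIf (yes _) e = w e
    wIf (no _)  e = 0#

  Adj : Subset m → Fin k → Fin k → Set
  Adj S u v = ∃ λ e → e ∉ S × ((src e ≡ u × dst e ≡ v) ⊎ (src e ≡ v × dst e ≡ u))

  Reach : Subset m → Fin k → Fin k → Set
  Reach S = Star (Adj S)

  -- G with the edges of S removed has exactly n connected components:
  -- a labelling of vertices by Fin n, onto, identifying exactly the
  -- vertices in the same component.
  NumComponents : Subset m → ℕ → Set
  NumComponents S n = Σ (Fin k → Fin n) λ c →
    Surjective _≡_ _≡_ c × (∀ u v → (c u ≡ c v) ⇔ Reach S u v)

  Connected : Set
  Connected = ∀ u v → Reach ⊥ u v

  Normalized : Set
  Normalized = weight ⊤ ≡ 1#

  -- S is an h-way split: removing S increases the number of connected
  -- components by exactly h - 1  (i.e. c' = c + h - 1, written c' + 1 = c + h)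
  IsSplit : Subset m → ℕ → Set
  IsSplit S h = ∃ λ c → ∃ λ c′ →
    NumComponents ⊥ c × NumComponents S c′ × c′ ℕ.+ 1 ≡ c ℕ.+ h

  density : Subset m → ℕ → Carrier
  density S h = weight S /ℕ (h ℕ.∸ 1)

  IsMinSplit : Subset m → ℕ → Set
  IsMinSplit T h = IsSplit T h × (∀ T′ → IsSplit T′ h → weight T ≤ weight T′)

module Submission where

-- Lemma 4.  Since G is connected, G − S has h components.  As h < k, some
-- vertex is not isolated in G − S; let v be one of minimum degree d there.
-- Cutting the edges of G − S at v isolates v, and adding these edges to S one
-- at a time creates at most one component per step, so some intermediate set
-- T₁ is an (h+1)-way split with w(T₁) ≤ w(S) + d; hence a minimum (h+1)-way
-- split T exists with w(T) ≤ w(S) + d.  At most h − 1 vertices are isolated in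
-- G − S, so p ≥ k − h + 1 ≥ 2 vertices are not, and the handshake lemma gives
-- p·d ≤ 2(1 − w(S)).  With w(S) ≤ (1+δ)(h−1)/k a computation in the ordered
-- field yields w(T)/h ≤ (1+δ)/k + (1−δ)/(hk).

open import Defs
open import Data.Nat as N using (ℕ; zero; suc)
import Data.Nat.Properties as ℕₚ
open import Data.Bool using (Bool; true; false; T; not; _∧_; _∨_)
open import Data.Fin using (Fin; zero; suc)
open import Data.Fin.Properties using (_≟_; suc-injective; any?; injective⇒≤)
open import Data.Fin.Subset using (Subset; _∈_; _∉_; ⁅_⁆; _∪_; ⊤) renaming (⊥ to ∅)
open import Data.Fin.Subset.Properties using (_∈?_; x∈p∪q⁻; x∈p∪q⁺; x∈⁅x⁆; x∈⁅y⁆⇒x≡y; ∈⊤)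
open import Data.List using (List; []; _∷_; tabulate; allFin)
open import Data.List.Relation.Unary.Any using (here; there)
open import Data.List.Membership.Propositional using () renaming (_∈_ to _∈ₗ_)
open import Data.List.Membership.Propositional.Properties using (∈-allFin)
open import Data.Vec using ([]; _∷_)
open import Data.Sum using (_⊎_; inj₁; inj₂; [_,_]′)
open import Data.Product using (Σ; ∃; _×_; _,_; proj₁; proj₂)
open import Data.Empty using (⊥-elim)
open import Data.Unit using (tt)
open import Function using (_∘_)
open import Algebra.Bundles using (CommutativeRing)
open import Function.Bundles using (Equivalence; mk⇔)
open import Relation.Nullary using (¬_; yes; no; Dec; does)
open import Relation.Nullary.Decidable using (_×-dec_; _⊎-dec_; ¬?; map′)
open import Relation.Binary.Bundles using (Poset)
open import Relation.Binary.Structures using (IsTotalOrder)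
open import Relation.Binary.PropositionalEquality hiding (poset)
open import Relation.Binary.Construct.Closure.ReflexiveTransitive using (Star; ε; _◅_; _◅◅_; gmap; reverse)

module OrderedFieldFacts (F : OrderedField) where
  open OrderedField F public

  commutativeRing : CommutativeRing _ _
  commutativeRing = record { isCommutativeRing = isCommutativeRing }

  open CommutativeRing commutativeRing public
    using (+-comm; +-assoc; *-comm; *-assoc; +-identityˡ; +-identityʳ; *-identityˡ; *-identityʳ;
           distribˡ; distribʳ; zeroˡ; -‿inverseʳ; -‿inverseˡ)
  open import Algebra.Properties.Ring (CommutativeRing.ring commutativeRing) public
    using (-‿distribˡ-*; -‿distribʳ-*; -‿involutive)
  -- a solver for commutative-semiring identities (negations are handled by hand)
  open import Algebra.Solver.Ring.NaturalCoefficients.Default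
    (CommutativeRing.commutativeSemiring commutativeRing) public
  open IsTotalOrder ≤-isTotalOrder public
    using (total) renaming (refl to ≤-refl; reflexive to ≤-reflexive; trans to ≤-trans; antisym to ≤-antisym)

  ≤-poset : Poset _ _ _
  ≤-poset = record { isPartialOrder = IsTotalOrder.isPartialOrder ≤-isTotalOrder }

  module ≤-Reasoning where
    open import Relation.Binary.Reasoning.PartialOrder ≤-poset public
      using (begin_; _∎; step-≤; step-≡-⟩; step-≡-⟨)

  ≤-resp : ∀ {x y x′ y′} → x ≡ x′ → y ≡ y′ → x ≤ y → x′ ≤ y′
  ≤-resp refl refl p = p

  +-monoʳ-≤ : ∀ {x y} z → x ≤ y → z + x ≤ z + y
  +-monoʳ-≤ {x} {y} z p = ≤-resp (+-comm x z) (+-comm y z) (+-monoˡ-≤ z p)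

  +-mono-≤ : ∀ {a b c d} → a ≤ b → c ≤ d → a + c ≤ b + d
  +-mono-≤ {a} {b} {c} {d} p q = ≤-trans (+-monoˡ-≤ c p) (+-monoʳ-≤ b q)

  0≤+ : ∀ {x y} → 0# ≤ x → 0# ≤ y → 0# ≤ x + y
  0≤+ p q = ≤-resp (+-identityʳ 0#) refl (+-mono-≤ p q)

  ≤-+ʳ : ∀ x {y} → 0# ≤ y → x ≤ x + y
  ≤-+ʳ x p = ≤-resp (+-identityʳ x) refl (+-monoʳ-≤ x p)

  neg-nonneg : ∀ {x} → x ≤ 0# → 0# ≤ - x
  neg-nonneg {x} p = ≤-resp (-‿inverseʳ x) (+-identityˡ (- x)) (+-monoˡ-≤ (- x) p)

  sub-nonneg : ∀ {x y} → x ≤ y → 0# ≤ y - x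
  sub-nonneg {x} {y} p = ≤-resp (-‿inverseʳ x) refl (+-monoˡ-≤ (- x) p)

  -- 0 ≤ 1, since otherwise 0 ≤ (-1)(-1) = 1 ≤ 0
  0≤1 : 0# ≤ 1#
  0≤1 with total 0# 1#
  ... | inj₁ p = p
  ... | inj₂ p = ⊥-elim (0≢1 (≤-antisym (≤-resp refl -1*-1≡1 (*-nonneg q q)) p))
    where
    q : 0# ≤ - 1#
    q = neg-nonneg p
    -1*-1≡1 : - 1# * - 1# ≡ 1#
    -1*-1≡1 = trans (sym (-‿distribˡ-* 1# (- 1#)))
                    (trans (cong -_ (*-identityˡ (- 1#))) (-‿involutive 1#))

  *-monoˡ-≤ : ∀ {x y} c → 0# ≤ c → x ≤ y → c * x ≤ c * y
  *-monoˡ-≤ {x} {y} c c≥0 p =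
    ≤-resp (+-identityˡ (c * x)) c[y-x]+cx≡cy (+-monoˡ-≤ (c * x) (*-nonneg c≥0 (sub-nonneg p)))
    where
    c[y-x]+cx≡cy : c * (y - x) + c * x ≡ c * y
    c[y-x]+cx≡cy = begin
      c * (y + - x) + c * x     ≡⟨ cong (_+ c * x) (distribˡ c y (- x)) ⟩
      c * y + c * - x + c * x   ≡⟨ cong (λ z → c * y + z + c * x) (sym (-‿distribʳ-* c x)) ⟩
      c * y + - (c * x) + c * x ≡⟨ +-assoc (c * y) _ _ ⟩
      c * y + (- (c * x) + c * x) ≡⟨ cong (c * y +_) (-‿inverseˡ (c * x)) ⟩
      c * y + 0#                ≡⟨ +-identityʳ (c * y) ⟩
      c * y                     ∎
      where open ≡-Reasoning

  *-monoʳ-≤ : ∀ {x y} c → 0# ≤ c → x ≤ y → x * c ≤ y * c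
  *-monoʳ-≤ {x} {y} c c≥0 p = ≤-resp (*-comm c x) (*-comm c y) (*-monoˡ-≤ c c≥0 p)

  fromℕ-+ : ∀ a b → fromℕ (a N.+ b) ≡ fromℕ a + fromℕ b
  fromℕ-+ zero    b = sym (+-identityˡ (fromℕ b))
  fromℕ-+ (suc a) b = trans (cong (1# +_) (fromℕ-+ a b)) (sym (+-assoc 1# (fromℕ a) (fromℕ b)))

  fromℕ-* : ∀ a b → fromℕ (a N.* b) ≡ fromℕ a * fromℕ b
  fromℕ-* zero    b = sym (zeroˡ (fromℕ b))
  fromℕ-* (suc a) b = begin
    fromℕ (b N.+ a N.* b)           ≡⟨ fromℕ-+ b (a N.* b) ⟩
    fromℕ b + fromℕ (a N.* b)       ≡⟨ cong (fromℕ b +_) (fromℕ-* a b) ⟩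
    fromℕ b + fromℕ a * fromℕ b     ≡⟨ solve 2 (λ a b → b :+ a :* b := (con 1 :+ a) :* b) refl (fromℕ a) (fromℕ b) ⟩
    (1# + fromℕ a) * fromℕ b        ∎
    where open ≡-Reasoning

  fromℕ-nonneg : ∀ n → 0# ≤ fromℕ n
  fromℕ-nonneg zero    = ≤-refl
  fromℕ-nonneg (suc n) = 0≤+ 0≤1 (fromℕ-nonneg n)

  fromℕ-mono : ∀ {a b} → a N.≤ b → fromℕ a ≤ fromℕ b
  fromℕ-mono {b = b} N.z≤n  = fromℕ-nonneg b
  fromℕ-mono (N.s≤s p)      = +-monoʳ-≤ 1# (fromℕ-mono p)

  -- the field has characteristic zero: 1 ≤ n + 1, and 1 ≠ 0
  fromℕ-suc≢0 : ∀ n → fromℕ (suc n) ≢ 0#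
  fromℕ-suc≢0 n n+1≡0 = 0≢1 (≤-antisym 0≤1 (≤-resp (+-identityʳ 1#) n+1≡0 1≤n+1))
    where
    1≤n+1 : fromℕ 1 ≤ fromℕ (suc n)
    1≤n+1 = fromℕ-mono {1} {suc n} (N.s≤s N.z≤n)

  -- a positive element has a positive inverse, since x · x⁻¹ = 1 > 0
  ⁻¹-nonneg : ∀ {x} → 0# ≤ x → x ≢ 0# → 0# ≤ x ⁻¹
  ⁻¹-nonneg {x} x≥0 x≢0 with total 0# (x ⁻¹)
  ... | inj₁ p = p
  ... | inj₂ p = ⊥-elim (0≢1 (≤-antisym 0≤1 (≤-resp (+-identityˡ 1#) (-‿inverseˡ 1#) (+-monoˡ-≤ 1# 0≤-1))))
    where
    0≤-1 : 0# ≤ - 1#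
    0≤-1 = ≤-resp refl (trans (sym (-‿distribʳ-* x (x ⁻¹))) (cong -_ (⁻¹-inverse x x≢0)))
                  (*-nonneg x≥0 (neg-nonneg p))

  *-cancelʳ-≤ : ∀ {x y} c → 0# ≤ c → c ≢ 0# → x * c ≤ y * c → x ≤ y
  *-cancelʳ-≤ {x} {y} c c≥0 c≢0 p = ≤-resp (undo x) (undo y) (*-monoʳ-≤ (c ⁻¹) (⁻¹-nonneg c≥0 c≢0) p)
    where
    undo : ∀ z → z * c * c ⁻¹ ≡ z
    undo z = trans (*-assoc z c (c ⁻¹)) (trans (cong (z *_) (⁻¹-inverse c c≢0)) (*-identityʳ z))

  /ℕ-*-cancel : ∀ n x → x /ℕ suc n * fromℕ (suc n) ≡ x
  /ℕ-*-cancel n x = begin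
    x * N ⁻¹ * N     ≡⟨ *-assoc x (N ⁻¹) N ⟩
    x * (N ⁻¹ * N)   ≡⟨ cong (x *_) (*-comm (N ⁻¹) N) ⟩
    x * (N * N ⁻¹)   ≡⟨ cong (x *_) (⁻¹-inverse N (fromℕ-suc≢0 n)) ⟩
    x * 1#           ≡⟨ *-identityʳ x ⟩
    x                ∎
    where
    open ≡-Reasoning
    N : Carrier
    N = fromℕ (suc n)

  /ℕ-≤⇒cross-≤ : ∀ a b x y → x /ℕ suc a ≤ y /ℕ suc b → x * fromℕ (suc b) ≤ y * fromℕ (suc a)
  /ℕ-≤⇒cross-≤ a b x y p = ≤-resp (scale x a b) (trans (cong (y /ℕ suc b *_) (*-comm A B)) (scale y b a))
    (*-monoʳ-≤ (A * B) (*-nonneg (fromℕ-nonneg (suc a)) (fromℕ-nonneg (suc b))) p)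
    where
    A B : Carrier
    A = fromℕ (suc a)
    B = fromℕ (suc b)
    scale : ∀ z c d → z /ℕ suc c * (fromℕ (suc c) * fromℕ (suc d)) ≡ z * fromℕ (suc d)
    scale z c d = trans (sym (*-assoc (z /ℕ suc c) (fromℕ (suc c)) (fromℕ (suc d))))
                        (cong (_* fromℕ (suc d)) (/ℕ-*-cancel c z))

module BoundArithmetic (F : OrderedField) where
  open OrderedFieldFacts F

  two : Carrier
  two = 1# + 1#

  -- Cleared of denominators: s is the weight of the split S with k·s ≤ (1+δ)(h−1),
  -- W = 1 − s the weight left in G − S, and d a vertex degree with p·d ≤ 2W for
  -- some p ≥ 2 such that k ≤ p + (h−1).
  cleared-bound : ∀ (p′ : ℕ) (K H₁ s d W δ : Carrier) → 0# ≤ K → 0# ≤ H₁ → 0# ≤ δ →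
    W + s ≡ 1# → s * K ≤ (1# + δ) * H₁ →
    fromℕ (suc (suc p′)) * d ≤ W + W → K ≤ fromℕ (suc (suc p′)) + H₁ →
    K * (s + d) ≤ (1# + δ) * H₁ + two
  cleared-bound p′ K H₁ s d W δ K≥0 H₁≥0 δ≥0 W+s≡1 sK≤A Pd≤2W K≤P+H₁ =
    *-cancelʳ-≤ P (fromℕ-nonneg (suc (suc p′))) (fromℕ-suc≢0 (suc p′)) (≤-resp (*-comm P _) (*-comm P _) scaled)
    where
    open ≤-Reasoning
    P′ P A : Carrier
    P′ = fromℕ p′
    P  = fromℕ (suc (suc p′))
    A  = (1# + δ) * H₁
    0≤two : 0# ≤ two
    0≤two = 0≤+ 0≤1 0≤1
    -- p·d + 2s ≤ 2W + 2s = 2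
    Pd+2s≤2 : P * d + two * s ≤ two
    Pd+2s≤2 = ≤-resp refl
      (trans (solve 2 (λ W s → W :+ W :+ (con 1 :+ con 1) :* s := (W :+ s) :+ (W :+ s)) refl W s)
             (cong₂ _+_ W+s≡1 W+s≡1))
      (+-monoˡ-≤ (two * s) Pd≤2W)
    scaled : P * (K * (s + d)) ≤ P * (A + two)
    scaled = begin
      P * (K * (s + d))
        ≡⟨ solve 4 (λ P′ K s d → (con 1 :+ (con 1 :+ P′)) :* (K :* (s :+ d))
                 := K :* ((con 1 :+ (con 1 :+ P′)) :* d :+ (con 1 :+ con 1) :* s) :+ P′ :* (K :* s))
                 refl P′ K s d ⟩
      K * (P * d + two * s) + P′ * (K * s)
        ≤⟨ +-mono-≤ (*-monoˡ-≤ K K≥0 Pd+2s≤2)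
                    (*-monoˡ-≤ P′ (fromℕ-nonneg p′) (≤-resp (*-comm s K) refl sK≤A)) ⟩
      K * two + P′ * A
        ≤⟨ +-monoˡ-≤ (P′ * A) (*-monoʳ-≤ two 0≤two K≤P+H₁) ⟩
      (P + H₁) * two + P′ * A
        ≤⟨ ≤-+ʳ _ (*-nonneg 0≤two (*-nonneg δ≥0 H₁≥0)) ⟩
      (P + H₁) * two + P′ * A + two * (δ * H₁)
        ≡⟨ solve 3 (λ P′ H₁ δ → (con 1 :+ (con 1 :+ P′) :+ H₁) :* (con 1 :+ con 1)
                     :+ P′ :* ((con 1 :+ δ) :* H₁) :+ (con 1 :+ con 1) :* (δ :* H₁)
                 := (con 1 :+ (con 1 :+ P′)) :* ((con 1 :+ δ) :* H₁ :+ (con 1 :+ con 1)))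
                 refl P′ H₁ δ ⟩
      P * (A + two) ∎

  target-scaled : ∀ a k′ δ →
    ((1# + δ) /ℕ suc k′ + (1# - δ) /ℕ (suc (suc a) N.* suc k′)) * (fromℕ (suc (suc a)) * fromℕ (suc k′))
      ≡ (1# + δ) * fromℕ (suc a) + two
  target-scaled a k′ δ = begin
    ((1# + δ) /ℕ suc k′ + (1# - δ) /ℕ hk) * (H * K)
      ≡⟨ distribʳ (H * K) _ _ ⟩
    (1# + δ) /ℕ suc k′ * (H * K) + (1# - δ) /ℕ hk * (H * K)
      ≡⟨ cong₂ _+_ (trans (cong ((1# + δ) /ℕ suc k′ *_) (*-comm H K))
                          (trans (sym (*-assoc _ K H)) (cong (_* H) (/ℕ-*-cancel k′ (1# + δ)))))
                   (trans (cong ((1# - δ) /ℕ hk *_) (sym (fromℕ-* (suc (suc a)) (suc k′))))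
                          (/ℕ-*-cancel (k′ N.+ suc a N.* suc k′) (1# - δ))) ⟩
    (1# + δ) * (1# + fromℕ (suc a)) + (1# + - δ)
      ≡⟨ solve 3 (λ δ nδ H₁ → (con 1 :+ δ) :* (con 1 :+ H₁) :+ (con 1 :+ nδ)
                   := (con 1 :+ δ) :* H₁ :+ (con 1 :+ con 1) :+ (δ :+ nδ)) refl δ (- δ) (fromℕ (suc a)) ⟩
    (1# + δ) * fromℕ (suc a) + two + (δ + - δ)
      ≡⟨ cong ((1# + δ) * fromℕ (suc a) + two +_) (-‿inverseʳ δ) ⟩
    (1# + δ) * fromℕ (suc a) + two + 0#
      ≡⟨ +-identityʳ _ ⟩
    (1# + δ) * fromℕ (suc a) + two ∎
    where
    open ≡-Reasoning
    hk : ℕ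
    hk = suc (suc a) N.* suc k′
    H K : Carrier
    H = fromℕ (suc (suc a))
    K = fromℕ (suc k′)

  -- The bound in the units of the theorem, for h = a + 2 and k = k′ + 1.
  density-bound : ∀ (a k′ p′ : ℕ) (s d W t δ : Carrier) → 0# ≤ δ → W + s ≡ 1# →
    s /ℕ suc a ≤ (1# + δ) /ℕ suc k′ →
    fromℕ (suc (suc p′)) * d ≤ W + W → suc k′ N.≤ suc (suc p′) N.+ suc a → t ≤ s + d →
    t /ℕ suc (suc a) ≤ (1# + δ) /ℕ suc k′ + (1# - δ) /ℕ (suc (suc a) N.* suc k′)
  density-bound a k′ p′ s d W t δ δ≥0 W+s≡1 dens Pd≤2W k≤p+h₁ t≤s+d =
    *-cancelʳ-≤ (H * K) (*-nonneg (fromℕ-nonneg (suc (suc a))) (fromℕ-nonneg (suc k′)))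
      (λ HK≡0 → fromℕ-suc≢0 (k′ N.+ suc a N.* suc k′) (trans (fromℕ-* (suc (suc a)) (suc k′)) HK≡0))
      (≤-resp (sym t-scaled) (sym (target-scaled a k′ δ)) Kt≤)
    where
    H K : Carrier
    H = fromℕ (suc (suc a))
    K = fromℕ (suc k′)
    t-scaled : t /ℕ suc (suc a) * (H * K) ≡ K * t
    t-scaled = trans (sym (*-assoc _ H K)) (trans (cong (_* K) (/ℕ-*-cancel (suc a) t)) (*-comm t K))
    Kt≤ : K * t ≤ (1# + δ) * fromℕ (suc a) + two
    Kt≤ = ≤-trans (*-monoˡ-≤ K (fromℕ-nonneg (suc k′)) t≤s+d)
      (cleared-bound p′ K (fromℕ (suc a)) s d W δ (fromℕ-nonneg (suc k′)) (fromℕ-nonneg (suc a)) δ≥0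
        W+s≡1 (/ℕ-≤⇒cross-≤ a k′ s (1# + δ) dens) Pd≤2W
        (≤-resp refl (fromℕ-+ (suc (suc p′)) (suc a)) (fromℕ-mono k≤p+h₁)))

does-true : ∀ {P : Set} (d : Dec P) → P → T (does d)
does-true (yes _)  _ = tt
does-true (no  ¬p) p = ¬p p

does-false : ∀ {P : Set} (d : Dec P) → T (not (does d)) → ¬ P
does-false (no ¬p) _ = ¬p

countTrue : ∀ n → (Fin n → Bool) → ℕ
countTrue zero    b = 0
countTrue (suc n) b with b zero
... | true  = suc (countTrue n (λ i → b (suc i)))
... | false = countTrue n (λ i → b (suc i))

enumTrue : ∀ n (b : Fin n → Bool) → Fin (countTrue n b) → Fin n
enumTrue (suc n) b i with b zero
enumTrue (suc n) b zero    | true  = zero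
enumTrue (suc n) b (suc i) | true  = suc (enumTrue n (λ j → b (suc j)) i)
enumTrue (suc n) b i       | false = suc (enumTrue n (λ j → b (suc j)) i)

enumTrue-true : ∀ n (b : Fin n → Bool) i → T (b (enumTrue n b i))
enumTrue-true (suc n) b i with b zero in eq
enumTrue-true (suc n) b zero    | true  = subst T (sym eq) tt
enumTrue-true (suc n) b (suc i) | true  = enumTrue-true n (λ j → b (suc j)) i
enumTrue-true (suc n) b i       | false = enumTrue-true n (λ j → b (suc j)) i

enumTrue-injective : ∀ n (b : Fin n → Bool) {i j} → enumTrue n b i ≡ enumTrue n b j → i ≡ j
enumTrue-injective (suc n) b {i} {j} eq with b zero
enumTrue-injective (suc n) b {zero}  {zero}  eq | true  = refl
enumTrue-injective (suc n) b {suc i} {suc j} eq | true  = cong suc (enumTrue-injective n _ (suc-injective eq))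
enumTrue-injective (suc n) b                 eq | false = enumTrue-injective n _ (suc-injective eq)

countTrue-complement : ∀ n (b : Fin n → Bool) → countTrue n b N.+ countTrue n (λ i → not (b i)) ≡ n
countTrue-complement zero    b = refl
countTrue-complement (suc n) b with b zero
... | true  = cong suc (countTrue-complement n _)
... | false = trans (ℕₚ.+-suc _ _) (cong suc (countTrue-complement n _))

module FiniteSums (F : OrderedField) where
  open OrderedFieldFacts F

  when : Bool → Carrier → Carrier
  when true  x = x
  when false x = 0#

  when-nonneg : ∀ b {x} → 0# ≤ x → 0# ≤ when b x
  when-nonneg true  p = p
  when-nonneg false p = ≤-refl

  sumF-cong : ∀ n {f g : Fin n → Carrier} → (∀ i → f i ≡ g i) → sumF n f ≡ sumF n g
  sumF-cong zero    eq = refl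
  sumF-cong (suc n) eq = cong₂ _+_ (eq zero) (sumF-cong n (λ i → eq (suc i)))

  sumF-mono : ∀ n {f g : Fin n → Carrier} → (∀ i → f i ≤ g i) → sumF n f ≤ sumF n g
  sumF-mono zero    le = ≤-refl
  sumF-mono (suc n) le = +-mono-≤ (le zero) (sumF-mono n (λ i → le (suc i)))

  sumF-zero : ∀ n → sumF n (λ _ → 0#) ≡ 0#
  sumF-zero zero    = refl
  sumF-zero (suc n) = trans (cong (0# +_) (sumF-zero n)) (+-identityˡ 0#)

  sumF-nonneg : ∀ n {f : Fin n → Carrier} → (∀ i → 0# ≤ f i) → 0# ≤ sumF n f
  sumF-nonneg n p = ≤-resp (sumF-zero n) refl (sumF-mono n p)

  sumF-+ : ∀ n (f g : Fin n → Carrier) → sumF n (λ i → f i + g i) ≡ sumF n f + sumF n g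
  sumF-+ zero    f g = sym (+-identityˡ 0#)
  sumF-+ (suc n) f g = trans (cong (f zero + g zero +_) (sumF-+ n _ _))
    (solve 4 (λ a b c d → (a :+ b) :+ (c :+ d) := (a :+ c) :+ (b :+ d)) refl _ _ _ _)

  sumF-swap : ∀ k m (f : Fin k → Fin m → Carrier) →
    sumF k (λ v → sumF m (f v)) ≡ sumF m (λ e → sumF k (λ v → f v e))
  sumF-swap zero    m f = sym (sumF-zero m)
  sumF-swap (suc k) m f = trans (cong (sumF m (f zero) +_) (sumF-swap k m _)) (sym (sumF-+ m _ _))

  sumF-point : ∀ n (u : Fin n) (g : Fin n → Carrier) → sumF n (λ v → when (does (u ≟ v)) (g v)) ≡ g u
  sumF-point (suc n) zero    g = trans (cong (g zero +_) (sumF-zero n)) (+-identityʳ (g zero))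
  sumF-point (suc n) (suc u) g = trans (+-identityˡ _) (sumF-point n u (λ i → g (suc i)))

  sumF-countTrue : ∀ n (b : Fin n → Bool) d → sumF n (λ v → when (b v) d) ≡ fromℕ (countTrue n b) * d
  sumF-countTrue zero    b d = sym (zeroˡ d)
  sumF-countTrue (suc n) b d with b zero
  ... | true  = trans (cong (d +_) (sumF-countTrue n _ d))
                      (solve 2 (λ d c → d :+ c :* d := (con 1 :+ c) :* d) refl d (fromℕ (countTrue n _)))
  ... | false = trans (+-identityˡ _) (sumF-countTrue n _ d)

module Minimisers (F : OrderedField) where
  open OrderedFieldFacts F

  Minimiser : (A : Set) (P : A → Set) (f : A → Carrier) → Set
  Minimiser A P f = Σ A λ x → P x × (∀ y → P y → f x ≤ f y)

  MinimiserOrNone : (A : Set) (P : A → Set) (f : A → Carrier) → Set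
  MinimiserOrNone A P f = (∀ x → ¬ P x) ⊎ Minimiser A P f

  minimiser-Fin : ∀ n (P : Fin n → Set) → (∀ x → Dec (P x)) → (f : Fin n → Carrier) → MinimiserOrNone (Fin n) P f
  minimiser-Fin zero    P P? f = inj₁ λ ()
  minimiser-Fin (suc n) P P? f with minimiser-Fin n (P ∘ suc) (P? ∘ suc) (f ∘ suc) | P? zero
  ... | inj₁ none | no ¬p0 = inj₁ λ { zero → ¬p0 ; (suc x) → none x }
  ... | inj₁ none | yes p0 = inj₂ (zero , p0 , λ { zero _ → ≤-refl ; (suc y) py → ⊥-elim (none y py) })
  ... | inj₂ (x , px , min) | no ¬p0 = inj₂ (suc x , px , λ { zero p0 → ⊥-elim (¬p0 p0) ; (suc y) py → min y py })
  ... | inj₂ (x , px , min) | yes p0 with total (f zero) (f (suc x))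
  ...   | inj₁ le = inj₂ (zero , p0 , λ { zero _ → ≤-refl ; (suc y) py → ≤-trans le (min y py) })
  ...   | inj₂ le = inj₂ (suc x , px , λ { zero _ → le ; (suc y) py → min y py })

  minimiser-Subset : ∀ n (P : Subset n → Set) → (∀ x → Dec (P x)) → (f : Subset n → Carrier) →
    MinimiserOrNone (Subset n) P f
  minimiser-Subset zero P P? f with P? []
  ... | yes p  = inj₂ ([] , p , λ { [] _ → ≤-refl })
  ... | no  ¬p = inj₁ λ { [] → ¬p }
  minimiser-Subset (suc n) P P? f
    with minimiser-Subset n (P ∘ (true ∷_)) (P? ∘ (true ∷_)) (f ∘ (true ∷_))
       | minimiser-Subset n (P ∘ (false ∷_)) (P? ∘ (false ∷_)) (f ∘ (false ∷_))
  ... | inj₁ none₁ | inj₁ none₀ = inj₁ λ { (true ∷ s) → none₁ s ; (false ∷ s) → none₀ s }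
  ... | inj₁ none₁ | inj₂ (x , px , min) =
    inj₂ (false ∷ x , px , λ { (true ∷ s) p → ⊥-elim (none₁ s p) ; (false ∷ s) p → min s p })
  ... | inj₂ (x , px , min) | inj₁ none₀ =
    inj₂ (true ∷ x , px , λ { (true ∷ s) p → min s p ; (false ∷ s) p → ⊥-elim (none₀ s p) })
  ... | inj₂ (x , px , min₁) | inj₂ (y , py , min₀) with total (f (true ∷ x)) (f (false ∷ y))
  ...   | inj₁ le = inj₂ (true ∷ x , px , λ { (true ∷ s) p → min₁ s p ; (false ∷ s) p → ≤-trans le (min₀ s p) })
  ...   | inj₂ le = inj₂ (false ∷ y , py , λ { (true ∷ s) p → ≤-trans le (min₁ s p) ; (false ∷ s) p → min₀ s p })

-- For the relation
-- "connected in G − S" the number of classes is the number of components.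
record Labelling (k : ℕ) (R : Fin k → Fin k → Set) : Set where
  field
    classes        : ℕ
    class          : Fin k → Fin classes
    representative : Fin classes → Fin k
    class-rep      : ∀ j → class (representative j) ≡ j
    sound          : ∀ {u v} → class u ≡ class v → R u v
    complete       : ∀ {u v} → R u v → class u ≡ class v

open Labelling

labelling : ∀ k (R : Fin k → Fin k → Set) → (∀ u v → Dec (R u v)) → (∀ u → R u u) →
  (∀ {u v} → R u v → R v u) → (∀ {u v w} → R u v → R v w → R u w) → Labelling k R
labelling zero    R R? rfl sym′ trans′ = record
  { classes = 0 ; class = λ () ; representative = λ () ; class-rep = λ ()
  ; sound = λ { {()} } ; complete = λ { {()} } }
labelling (suc k) R R? rfl sym′ trans′
  with labelling k (λ u v → R (suc u) (suc v)) (λ u v → R? (suc u) (suc v)) (λ u → rfl (suc u)) sym′ trans′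
     | any? (λ j → R? zero (suc j))
... | L | yes (j , r) = record
  { classes = classes L ; class = cls ; representative = λ i → suc (representative L i)
  ; class-rep = class-rep L ; sound = snd ; complete = cmp }
  where
  cls : Fin (suc k) → Fin (classes L)
  cls zero    = class L j
  cls (suc u) = class L u
  snd : ∀ {u v} → cls u ≡ cls v → R u v
  snd {zero}  {zero}  _ = rfl zero
  snd {zero}  {suc v} e = trans′ r (sound L e)
  snd {suc u} {zero}  e = sym′ (trans′ r (sound L (sym e)))
  snd {suc u} {suc v} e = sound L e
  cmp : ∀ {u v} → R u v → cls u ≡ cls v
  cmp {zero}  {zero}  _ = refl
  cmp {zero}  {suc v} q = complete L (trans′ (sym′ r) q)
  cmp {suc u} {zero}  q = sym (complete L (trans′ (sym′ r) (sym′ q)))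
  cmp {suc u} {suc v} q = complete L q
... | L | no ¬r = record
  { classes = suc (classes L) ; class = cls ; representative = rep
  ; class-rep = cls-rep ; sound = snd ; complete = cmp }
  where
  cls : Fin (suc k) → Fin (suc (classes L))
  cls zero    = zero
  cls (suc u) = suc (class L u)
  rep : Fin (suc (classes L)) → Fin (suc k)
  rep zero    = zero
  rep (suc i) = suc (representative L i)
  cls-rep : ∀ j → cls (rep j) ≡ j
  cls-rep zero    = refl
  cls-rep (suc j) = cong suc (class-rep L j)
  snd : ∀ {u v} → cls u ≡ cls v → R u v
  snd {zero}  {zero}  _ = rfl zero
  snd {suc u} {suc v} e = sound L (suc-injective e)
  cmp : ∀ {u v} → R u v → cls u ≡ cls v
  cmp {zero}  {zero}  _ = refl
  cmp {zero}  {suc v} q = ⊥-elim (¬r (v , q))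
  cmp {suc u} {zero}  q = ⊥-elim (¬r (u , sym′ q))
  cmp {suc u} {suc v} q = cong suc (complete L q)

classes-antitone : ∀ {k} {R R′ : Fin k → Fin k → Set} → (∀ {u v} → R u v → R′ u v) →
  (L : Labelling k R) (L′ : Labelling k R′) → classes L′ N.≤ classes L
classes-antitone R⊆R′ L L′ = injective⇒≤ {f = λ i → class L (representative L′ i)} λ {i} {j} e →
  trans (sym (class-rep L′ i)) (trans (complete L′ (R⊆R′ (sound L e))) (class-rep L′ j))

classes-unique : ∀ {k} {R : Fin k → Fin k → Set} (L L′ : Labelling k R) → classes L ≡ classes L′
classes-unique L L′ = ℕₚ.≤-antisym (classes-antitone (λ r → r) L′ L) (classes-antitone (λ r → r) L L′)

Isolated : ∀ {k} → (Fin k → Fin k → Set) → Fin k → Set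
Isolated R x = ∀ {y} → R x y → y ≡ x

-- If R′ is generated by R together with one extra link a — b, then linking
-- merges at most two classes: R has at most one class more than R′.
classes-merge : ∀ {k} {R R′ : Fin k → Fin k → Set} (a b : Fin k) →
  (∀ {u v} → R′ u v → R u v ⊎ (R u a × R b v) ⊎ (R u b × R a v)) →
  (L : Labelling k R) (L′ : Labelling k R′) → classes L N.≤ suc (classes L′)
classes-merge {k} {R} {R′} a b R′⊆link L L′ = injective⇒≤ {f = g} g-injective
  where
  -- the class of b is sent apart, every other class to its R′-class
  g : Fin (classes L) → Fin (suc (classes L′))
  g i with i ≟ class L b
  ... | yes _ = zero
  ... | no  _ = suc (class L′ (representative L i))
  g-injective : ∀ {i j} → g i ≡ g j → i ≡ j
  g-injective {i} {j} eq with i ≟ class L b | j ≟ class L b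
  ... | yes p | yes q = trans p (sym q)
  ... | no  p | no  q with R′⊆link (sound L′ (suc-injective eq))
  ...   | inj₁ r = trans (sym (class-rep L i)) (trans (complete L r) (class-rep L j))
  ...   | inj₂ (inj₁ (_ , r)) = ⊥-elim (q (trans (sym (class-rep L j)) (sym (complete L r))))
  ...   | inj₂ (inj₂ (r , _)) = ⊥-elim (p (trans (sym (class-rep L i)) (complete L r)))

classes-isolate : ∀ {k} {R R′ : Fin k → Fin k → Set} → (∀ {u v} → R u v → R′ u v) →
  (v₀ u₀ : Fin k) → u₀ ≢ v₀ → R′ v₀ u₀ → Isolated R v₀ →
  (L : Labelling k R) (L′ : Labelling k R′) → suc (classes L′) N.≤ classes L
classes-isolate {k} {R} {R′} R⊆R′ v₀ u₀ u₀≢v₀ r′ v₀-isolated L L′ = injective⇒≤ {f = g} g-injective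
  where
  -- a representative of each R′-class different from v₀
  rep : Fin (classes L′) → Fin k
  rep j with representative L′ j ≟ v₀
  ... | yes _ = u₀
  ... | no  _ = representative L′ j
  rep-class : ∀ j → class L′ (rep j) ≡ j
  rep-class j with representative L′ j ≟ v₀
  ... | yes p = trans (sym (complete L′ r′)) (trans (cong (class L′) (sym p)) (class-rep L′ j))
  ... | no  _ = class-rep L′ j
  rep≢v₀ : ∀ j → rep j ≢ v₀
  rep≢v₀ j with representative L′ j ≟ v₀
  ... | yes _ = u₀≢v₀
  ... | no  p = p
  g : Fin (suc (classes L′)) → Fin (classes L)
  g zero    = class L v₀
  g (suc j) = class L (rep j)
  g-injective : ∀ {i j} → g i ≡ g j → i ≡ j
  g-injective {zero}  {zero}  eq = refl
  g-injective {zero}  {suc j} eq = ⊥-elim (rep≢v₀ j (v₀-isolated (sound L eq)))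
  g-injective {suc i} {zero}  eq = ⊥-elim (rep≢v₀ i (v₀-isolated (sound L (sym eq))))
  g-injective {suc i} {suc j} eq =
    cong suc (trans (sym (rep-class i)) (trans (complete L′ (R⊆R′ (sound L eq))) (rep-class j)))

-- Each isolated point is a class of its own; if some point v is not isolated,
-- its class is one more.
classes-isolated : ∀ {k} {R : Fin k → Fin k → Set} (L : Labelling k R) (isolated : Fin k → Bool) →
  (∀ x → T (isolated x) → Isolated R x) → (v : Fin k) → ¬ T (isolated v) →
  suc (countTrue k isolated) N.≤ classes L
classes-isolated {k} {R} L isolated isolated-sound v v-not-isolated = injective⇒≤ {f = g} g-injective
  where
  iso : Fin (countTrue k isolated) → Fin k
  iso = enumTrue k isolated
  iso-isolated : ∀ i → Isolated R (iso i)
  iso-isolated i = isolated-sound (iso i) (enumTrue-true k isolated i)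
  v-apart : ∀ i → class L v ≢ class L (iso i)
  v-apart i eq = v-not-isolated (subst (T ∘ isolated) (sym (iso-isolated i (sound L (sym eq)))) (enumTrue-true k isolated i))
  g : Fin (suc (countTrue k isolated)) → Fin (classes L)
  g zero    = class L v
  g (suc i) = class L (iso i)
  g-injective : ∀ {i j} → g i ≡ g j → i ≡ j
  g-injective {zero}  {zero}  eq = refl
  g-injective {zero}  {suc j} eq = ⊥-elim (v-apart j eq)
  g-injective {suc i} {zero}  eq = ⊥-elim (v-apart i (sym eq))
  g-injective {suc i} {suc j} eq =
    cong suc (enumTrue-injective k isolated (sym (iso-isolated i (sound L eq))))

classes-discrete : ∀ {k} {R : Fin k → Fin k → Set} (L : Labelling k R) →
  (∀ x → Isolated R x) → k N.≤ classes L
classes-discrete L all-isolated = injective⇒≤ {f = class L} λ {x} eq → sym (all-isolated x (sound L eq))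

module Reachability {F : OrderedField} {k m : ℕ} (G : WGraph F k m) where
  open WGraph G
  open Minimisers F

  Joins : Fin m → Fin k → Fin k → Set
  Joins e u v = (src e ≡ u × dst e ≡ v) ⊎ (src e ≡ v × dst e ≡ u)

  AdjVia : (Fin m → Set) → Fin k → Fin k → Set
  AdjVia Q u v = ∃ λ e → Q e × Joins e u v

  ReachVia : (Fin m → Set) → Fin k → Fin k → Set
  ReachVia Q = Star (AdjVia Q)

  -- the edges of G − S; ReachVia (Kept S) is definitionally Reach G S
  Kept : Subset m → Fin m → Set
  Kept S e = e ∉ S

  reach-sym : ∀ {Q u v} → ReachVia Q u v → ReachVia Q v u
  reach-sym = reverse λ { (e , q , inj₁ (s , d)) → e , q , inj₂ (s , d)
                        ; (e , q , inj₂ (s , d)) → e , q , inj₁ (s , d) }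

  reach-mono : ∀ {Q Q′ : Fin m → Set} → (∀ e → Q e → Q′ e) → ∀ {u v} → ReachVia Q u v → ReachVia Q′ u v
  reach-mono Q⊆Q′ = gmap (λ x → x) (λ { (e , q , j) → e , Q⊆Q′ e q , j })

  edge-reach : ∀ {Q : Fin m → Set} e → Q e → ReachVia Q (src e) (dst e)
  edge-reach e q = (e , q , inj₁ (refl , refl)) ◅ ε

  ThroughEdge : (Fin m → Set) → Fin m → Fin k → Fin k → Set
  ThroughEdge Q e u v = ReachVia Q u v
    ⊎ (ReachVia Q u (src e) × ReachVia Q (dst e) v)
    ⊎ (ReachVia Q u (dst e) × ReachVia Q (src e) v)

  -- A path using Q′ ⊆ Q ∪ {e} crosses e at most once (after shortcutting).
  reach-through : ∀ {Q Q′ : Fin m → Set} e → (∀ e′ → Q′ e′ → Q e′ ⊎ e′ ≡ e) →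
    ∀ {u v} → ReachVia Q′ u v → ThroughEdge Q e u v
  reach-through e Q′⊆Q+e ε = inj₁ ε
  reach-through {Q} e Q′⊆Q+e {u} {v} (_◅_ {j = w} (e′ , q′ , j) rest)
    with reach-through e Q′⊆Q+e rest | Q′⊆Q+e e′ q′
  ... | through | inj₁ q = prepend through
    where
    first : ReachVia Q u w
    first = (e′ , q , j) ◅ ε
    prepend : ThroughEdge Q e w v → ThroughEdge Q e u v
    prepend (inj₁ r)             = inj₁ (first ◅◅ r)
    prepend (inj₂ (inj₁ (r , s))) = inj₂ (inj₁ (first ◅◅ r , s))
    prepend (inj₂ (inj₂ (r , s))) = inj₂ (inj₂ (first ◅◅ r , s))
  reach-through {Q} e Q′⊆Q+e (_◅_ (e′ , q′ , inj₁ (refl , refl)) rest) | through | inj₂ refl = cross through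
    where
    cross : ∀ {v} → ThroughEdge Q e (dst e) v → ThroughEdge Q e (src e) v
    cross (inj₁ r)             = inj₂ (inj₁ (ε , r))
    cross (inj₂ (inj₁ (r , s))) = inj₁ (reach-sym r ◅◅ s)
    cross (inj₂ (inj₂ (_ , s))) = inj₁ s
  reach-through {Q} e Q′⊆Q+e (_◅_ (e′ , q′ , inj₂ (refl , refl)) rest) | through | inj₂ refl = cross through
    where
    cross : ∀ {v} → ThroughEdge Q e (src e) v → ThroughEdge Q e (dst e) v
    cross (inj₁ r)             = inj₂ (inj₂ (ε , r))
    cross (inj₂ (inj₁ (_ , s))) = inj₁ s
    cross (inj₂ (inj₂ (r , s))) = inj₁ (reach-sym r ◅◅ s)

  through-reach : ∀ {Q Q′ : Fin m → Set} e → (∀ e′ → Q e′ → Q′ e′) → Q′ e →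
    ∀ {u v} → ThroughEdge Q e u v → ReachVia Q′ u v
  through-reach e Q⊆Q′ q (inj₁ r) = reach-mono Q⊆Q′ r
  through-reach e Q⊆Q′ q (inj₂ (inj₁ (r , s))) = reach-mono Q⊆Q′ r ◅◅ edge-reach e q ◅◅ reach-mono Q⊆Q′ s
  through-reach e Q⊆Q′ q (inj₂ (inj₂ (r , s))) =
    reach-mono Q⊆Q′ r ◅◅ reach-sym (edge-reach e q) ◅◅ reach-mono Q⊆Q′ s

  ListedKept : Subset m → List (Fin m) → Fin m → Set
  ListedKept S L e = e ∈ₗ L × e ∉ S

  reach-listed? : ∀ S L u v → Dec (ReachVia (ListedKept S L) u v)
  reach-listed? S [] u v with u ≟ v
  ... | yes refl = yes ε
  ... | no  u≢v  = no λ { ε → u≢v refl ; ((_ , (() , _) , _) ◅ _) }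
  reach-listed? S (x ∷ L) u v with x ∈? S
  ... | yes x∈S = map′ (reach-mono (λ e q → there (proj₁ q) , proj₂ q)) (reach-mono drop-x) (reach-listed? S L u v)
    where
    drop-x : ∀ e → ListedKept S (x ∷ L) e → ListedKept S L e
    drop-x e (here refl , e∉S) = ⊥-elim (e∉S x∈S)
    drop-x e (there i , e∉S) = i , e∉S
  ... | no x∉S = map′ (through-reach x (λ e q → there (proj₁ q) , proj₂ q) (here refl , x∉S)) (reach-through x split-x)
      (R? u v ⊎-dec ((R? u (src x) ×-dec R? (dst x) v) ⊎-dec (R? u (dst x) ×-dec R? (src x) v)))
    where
    R? : ∀ u v → Dec (ReachVia (ListedKept S L) u v)
    R? = reach-listed? S L
    split-x : ∀ e → ListedKept S (x ∷ L) e → ListedKept S L e ⊎ e ≡ x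
    split-x e (here refl , _) = inj₂ refl
    split-x e (there i , e∉S) = inj₁ (i , e∉S)

  reach? : ∀ S u v → Dec (ReachVia (Kept S) u v)
  reach? S u v = map′ (reach-mono (λ e q → proj₂ q)) (reach-mono (λ e q → ∈-allFin e , q))
                      (reach-listed? S (allFin m) u v)

  components : ∀ S → Labelling k (ReachVia (Kept S))
  components S = labelling k _ (reach? S) (λ _ → ε) reach-sym _◅◅_

  #components : Subset m → ℕ
  #components S = classes (components S)

  numComponents-unique : ∀ {S n} → NumComponents G S n → #components S ≡ n
  numComponents-unique {S} {n} (c , c-onto , c-exact) = classes-unique (components S) L
    where
    L : Labelling k (ReachVia (Kept S))
    L = record
      { classes = n ; class = c ; representative = λ y → proj₁ (c-onto y)
      ; class-rep = λ y → proj₂ (c-onto y) refl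
      ; sound = Equivalence.to (c-exact _ _) ; complete = Equivalence.from (c-exact _ _) }

  numComponents-components : ∀ S → NumComponents G S (#components S)
  numComponents-components S =
    class L , (λ y → representative L y , λ { refl → class-rep L y }) , (λ u v → mk⇔ (sound L) (complete L))
    where L = components S

  module Splits (connected : Connected G) (v₀ : Fin k) where

    one-component : NumComponents G ∅ 1
    one-component = (λ _ → zero) , (λ { zero → v₀ , λ _ → refl }) , (λ u v → mk⇔ (λ _ → connected u v) (λ _ → refl))

    split⇒#components : ∀ {S h} → IsSplit G S h → #components S ≡ h
    split⇒#components {S} {h} (c , c′ , nc , nc′ , c′+1≡c+h) = ℕₚ.+-cancelʳ-≡ 1 (#components S) h (begin
      #components S N.+ 1 ≡⟨ cong (N._+ 1) (numComponents-unique nc′) ⟩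
      c′ N.+ 1            ≡⟨ c′+1≡c+h ⟩
      c N.+ h             ≡⟨ cong (N._+ h) (trans (sym (numComponents-unique nc)) (numComponents-unique one-component)) ⟩
      1 N.+ h             ≡⟨ ℕₚ.+-comm 1 h ⟩
      h N.+ 1             ∎)
      where open ≡-Reasoning

    #components⇒split : ∀ {S h} → #components S ≡ h → IsSplit G S h
    #components⇒split {S} {h} eq =
      1 , #components S , one-component , numComponents-components S , trans (ℕₚ.+-comm (#components S) 1) (cong suc eq)

    split? : ∀ S h → Dec (IsSplit G S h)
    split? S h = map′ #components⇒split split⇒#components (#components S N.≟ h)

    minimum-split : ∀ {S h} → IsSplit G S h → Σ (Subset m) λ T → IsMinSplit G T h
    minimum-split {S} {h} S-split with minimiser-Subset m (λ T → IsSplit G T h) (λ T → split? T h) (weight G)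
    ... | inj₁ none = ⊥-elim (none S S-split)
    ... | inj₂ (T , T-split , T-minimal) = T , T-split , T-minimal

  insertIf : Bool → Fin m → Subset m → Subset m
  insertIf true  e S = ⁅ e ⁆ ∪ S
  insertIf false e S = S

  insertIf-⊇ : ∀ b e {S x} → x ∈ S → x ∈ insertIf b e S
  insertIf-⊇ true  e p = x∈p∪q⁺ (inj₂ p)
  insertIf-⊇ false e p = p

  insertIf-components : ∀ b e S → #components (insertIf b e S) N.≤ suc (#components S)
  insertIf-components false e S = ℕₚ.n≤1+n _
  insertIf-components true  e S =
    classes-merge (src e) (dst e) (reach-through e kept-or-e) (components (⁅ e ⁆ ∪ S)) (components S)
    where
    kept-or-e : ∀ e′ → Kept S e′ → Kept (⁅ e ⁆ ∪ S) e′ ⊎ e′ ≡ e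
    kept-or-e e′ e′∉S with e′ ≟ e
    ... | yes eq  = inj₂ eq
    ... | no  e′≢e = inj₁ λ p → [ (λ q → e′≢e (x∈⁅y⁆⇒x≡y e q)) , e′∉S ]′ (x∈p∪q⁻ ⁅ e ⁆ S p)

  addAll : (Fin m → Bool) → Subset m → List (Fin m) → Subset m
  addAll P S []      = S
  addAll P S (e ∷ L) = addAll P (insertIf (P e) e S) L

  addAll-⊇ : ∀ P L {S x} → x ∈ S → x ∈ addAll P S L
  addAll-⊇ P []      p = p
  addAll-⊇ P (e ∷ L) p = addAll-⊇ P L (insertIf-⊇ (P e) e p)

  addAll-∋ : ∀ P L {S e} → e ∈ₗ L → T (P e) → e ∈ addAll P S L
  addAll-∋ P (x ∷ L) (here refl) t with P x
  ... | true = addAll-⊇ P L (x∈p∪q⁺ (inj₁ (x∈⁅x⁆ x)))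
  addAll-∋ P (x ∷ L) (there i)   t = addAll-∋ P L i t

  -- Discrete intermediate value theorem: the number of components grows by at
  -- most one per added edge, so every intermediate value is attained.
  intermediate-split : ∀ P h L S → #components S N.≤ suc h → suc h N.≤ #components (addAll P S L) →
    Σ (Subset m) λ T → #components T ≡ suc h × (∀ x → x ∈ T → x ∈ addAll P S L)
  intermediate-split P h []      S below above = S , ℕₚ.≤-antisym below above , λ x i → i
  intermediate-split P h (e ∷ L) S below above with #components S N.≟ suc h
  ... | yes eq = S , eq , λ x i → addAll-⊇ P (e ∷ L) i
  ... | no  ne = intermediate-split P h L (insertIf (P e) e S)
                   (ℕₚ.≤-trans (insertIf-components (P e) e S) (N.s≤s (ℕₚ.≤-pred (ℕₚ.≤∧≢⇒< below ne)))) above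

  no-edge⇒isolated : ∀ {S v} → (∀ e → e ∉ S → ¬ (src e ≡ v ⊎ dst e ≡ v)) → Isolated (ReachVia (Kept S)) v
  no-edge⇒isolated no-edge ε = refl
  no-edge⇒isolated no-edge ((e , e∉S , inj₁ (s , _)) ◅ _) = ⊥-elim (no-edge e e∉S (inj₁ s))
  no-edge⇒isolated no-edge ((e , e∉S , inj₂ (_ , d)) ◅ _) = ⊥-elim (no-edge e e∉S (inj₂ d))

module Weights {F : OrderedField} {k m : ℕ} (G : WGraph F k m) where
  open OrderedFieldFacts F
  open FiniteSums F
  open Reachability G
  open WGraph G

  w-nonneg : ∀ e → 0# ≤ w e
  w-nonneg e = proj₁ (w-pos e)

  weightOf : Subset m → Fin m → Carrier
  weightOf S e = when (does (e ∈? S)) (w e)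

  -- The summand of `weight` is local to Defs and cannot be named, so the
  -- type of the pointwise identity is left to inference.
  mutual
    weight-sum : ∀ S → weight G S ≡ sumF m (weightOf S)
    weight-sum S = sumF-cong m (summand-weightOf S)

    summand-weightOf : ∀ S (e : Fin m) → _
    summand-weightOf S e with e ∈? S
    ... | yes _ = refl
    ... | no  _ = refl

  weight-mono : ∀ {S T} → (∀ x → x ∈ S → x ∈ T) → weight G S ≤ weight G T
  weight-mono {S} {T} S⊆T = ≤-resp (sym (weight-sum S)) (sym (weight-sum T)) (sumF-mono m pointwise)
    where
    pointwise : ∀ e → weightOf S e ≤ weightOf T e
    pointwise e with e ∈? S | e ∈? T
    ... | yes _   | yes _   = ≤-refl
    ... | yes e∈S | no  e∉T = ⊥-elim (e∉T (S⊆T e e∈S))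
    ... | no  _   | d       = when-nonneg (does d) (w-nonneg e)

  weight-insertIf : ∀ b e S → weight G (insertIf b e S) ≤ weight G S + when b (w e)
  weight-insertIf false e S = ≤-reflexive (sym (+-identityʳ _))
  weight-insertIf true  e S = ≤-resp (sym (weight-sum (⁅ e ⁆ ∪ S)))
      (trans (sumF-+ m _ _) (cong₂ _+_ (sym (weight-sum S)) (sumF-point m e w)))
      (sumF-mono m pointwise)
    where
    pointwise : ∀ x → weightOf (⁅ e ⁆ ∪ S) x ≤ weightOf S x + when (does (e ≟ x)) (w x)
    pointwise x with x ∈? (⁅ e ⁆ ∪ S) | x ∈? S | e ≟ x
    ... | yes _ | yes _ | d     = ≤-+ʳ (w x) (when-nonneg (does d) (w-nonneg x))
    ... | yes _ | no  _ | yes _ = ≤-reflexive (sym (+-identityˡ (w x)))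
    ... | yes p | no x∉S | no e≢x = ⊥-elim ([ (λ q → e≢x (sym (x∈⁅y⁆⇒x≡y e q))) , x∉S ]′ (x∈p∪q⁻ ⁅ e ⁆ S p))
    ... | no  _ | d     | d′    = 0≤+ (when-nonneg (does d) (w-nonneg x)) (when-nonneg (does d′) (w-nonneg x))

  listWeight : (Fin m → Bool) → List (Fin m) → Carrier
  listWeight P []      = 0#
  listWeight P (e ∷ L) = when (P e) (w e) + listWeight P L

  weight-addAll : ∀ P L S → weight G (addAll P S L) ≤ weight G S + listWeight P L
  weight-addAll P []      S = ≤-reflexive (sym (+-identityʳ _))
  weight-addAll P (e ∷ L) S = ≤-trans (weight-addAll P L (insertIf (P e) e S))
    (≤-resp refl (+-assoc _ _ _) (+-monoˡ-≤ (listWeight P L) (weight-insertIf (P e) e S)))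

  listWeight-tabulate : ∀ P n (f : Fin n → Fin m) →
    listWeight P (tabulate f) ≡ sumF n (λ i → when (P (f i)) (w (f i)))
  listWeight-tabulate P zero    f = refl
  listWeight-tabulate P (suc n) f = cong (when (P (f zero)) (w (f zero)) +_) (listWeight-tabulate P n (f ∘ suc))

  restWeight : Subset m → Carrier
  restWeight S = sumF m (λ e → when (not (does (e ∈? S))) (w e))

  weight-complement : ∀ S → weight G S + restWeight S ≡ weight G ⊤
  weight-complement S =
    trans (cong (_+ restWeight S) (weight-sum S))
      (trans (sym (sumF-+ m _ _)) (trans (sumF-cong m pointwise) (sym (weight-sum ⊤))))
    where
    pointwise : ∀ e → weightOf S e + when (not (does (e ∈? S))) (w e) ≡ weightOf ⊤ e
    pointwise e with e ∈? S | e ∈? ⊤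
    ... | yes _ | yes _ = +-identityʳ (w e)
    ... | no  _ | yes _ = +-identityˡ (w e)
    ... | _     | no e∉⊤ = ⊥-elim (e∉⊤ ∈⊤)

enough-non-isolated : ∀ p i k a → p N.+ i ≡ k → i N.≤ suc a → suc (suc (suc a)) N.≤ k →
  Σ ℕ λ p′ → p ≡ suc (suc p′) × k N.≤ suc (suc p′) N.+ suc a
enough-non-isolated zero          i .i a refl i≤a+1 a+3≤i =
  ⊥-elim (ℕₚ.<⇒≱ (ℕₚ.≤-trans (N.s≤s (N.s≤s (ℕₚ.n≤1+n a))) a+3≤i) i≤a+1)
enough-non-isolated (suc zero)    i .(suc i) a refl i≤a+1 a+3≤1+i = ⊥-elim (ℕₚ.<⇒≱ (ℕₚ.≤-pred a+3≤1+i) i≤a+1)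
enough-non-isolated (suc (suc p′)) i .(suc (suc p′) N.+ i) a refl i≤a+1 _ = p′ , refl , ℕₚ.+-monoʳ-≤ (suc (suc p′)) i≤a+1

module Degrees {F : OrderedField} {k m : ℕ} (G : WGraph F k m) (S : Subset m) where
  open OrderedFieldFacts F
  open FiniteSums F
  open Minimisers F
  open Reachability G
  open Weights G
  open WGraph G

  IncidentKept : Fin k → Fin m → Set
  IncidentKept v e = e ∉ S × (src e ≡ v ⊎ dst e ≡ v)

  incidentKept? : ∀ v e → Dec (IncidentKept v e)
  incidentKept? v e = ¬? (e ∈? S) ×-dec ((src e ≟ v) ⊎-dec (dst e ≟ v))

  incident : Fin k → Fin m → Bool
  incident v e = does (incidentKept? v e)

  degree : Fin k → Carrier
  degree v = sumF m (λ e → when (incident v e) (w e))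

  degree-nonneg : ∀ v → 0# ≤ degree v
  degree-nonneg v = sumF-nonneg m (λ e → when-nonneg (incident v e) (w-nonneg e))

  NonIsolated : Fin k → Set
  NonIsolated v = ∃ (IncidentKept v)

  nonIsolated? : ∀ v → Dec (NonIsolated v)
  nonIsolated? v = any? (incidentKept? v)

  ¬nonIsolated⇒isolated : ∀ {v} → ¬ NonIsolated v → Isolated (ReachVia (Kept S)) v
  ¬nonIsolated⇒isolated ¬ni = no-edge⇒isolated (λ e e∉S inc → ¬ni (e , e∉S , inc))

  -- Handshake lemma: every edge of G − S is counted at its two endpoints.
  handshake : sumF k degree ≤ restWeight S + restWeight S
  handshake = begin
    sumF k degree
      ≤⟨ sumF-mono k (λ v → sumF-mono m (λ e → split-endpoints (kept e) (does (src e ≟ v)) (does (dst e ≟ v)) (w-nonneg e))) ⟩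
    sumF k (λ v → sumF m (λ e → at src v e + at dst v e))
      ≡⟨ sumF-cong k (λ v → sumF-+ m (at src v) (at dst v)) ⟩
    sumF k (λ v → sumF m (at src v) + sumF m (at dst v))
      ≡⟨ sumF-+ k (λ v → sumF m (at src v)) (λ v → sumF m (at dst v)) ⟩
    sumF k (λ v → sumF m (at src v)) + sumF k (λ v → sumF m (at dst v))
      ≡⟨ cong₂ _+_ (endpoint-sum src) (endpoint-sum dst) ⟩
    restWeight S + restWeight S ∎
    where
    open ≤-Reasoning
    kept : Fin m → Bool
    kept e = not (does (e ∈? S))
    at : (Fin m → Fin k) → Fin k → Fin m → Carrier
    at end v e = when (kept e ∧ does (end e ≟ v)) (w e)
    split-endpoints : ∀ a b c {x} → 0# ≤ x → when (a ∧ (b ∨ c)) x ≤ when (a ∧ b) x + when (a ∧ c) x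
    split-endpoints true  true  true  x≥0 = ≤-+ʳ _ x≥0
    split-endpoints true  true  false x≥0 = ≤-reflexive (sym (+-identityʳ _))
    split-endpoints true  false c     x≥0 = ≤-reflexive (sym (+-identityˡ _))
    split-endpoints false b     c     x≥0 = ≤-reflexive (sym (+-identityˡ _))
    at-point : ∀ a (u : Fin k) x → sumF k (λ v → when (a ∧ does (u ≟ v)) x) ≡ when a x
    at-point true  u x = sumF-point k u (λ _ → x)
    at-point false u x = sumF-zero k
    endpoint-sum : ∀ end → sumF k (λ v → sumF m (at end v)) ≡ restWeight S
    endpoint-sum end = trans (sumF-swap k m (at end)) (sumF-cong m (λ e → at-point (kept e) (end e) (w e)))

  -- Removing the edges of G − S at a non-isolated vertex v isolates v, which
  -- raises the number of components; adding those edges one at a time passes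
  -- through exactly one more component than G − S, at extra cost ≤ degree v.
  star-split : ∀ h v → #components S ≡ h → NonIsolated v →
    Σ (Subset m) λ T → #components T ≡ suc h × weight G T ≤ weight G S + degree v
  star-split h v #S≡h (e , e∉S , e-at-v) =
    let (T₁ , #T₁≡h+1 , T₁⊆T₀) = intermediate-split star h (allFin m) S S-below T₀-above
    in T₁ , #T₁≡h+1 , ≤-trans (weight-mono T₁⊆T₀) weight-T₀
    where
    star : Fin m → Bool
    star = incident v
    T₀ : Subset m
    T₀ = addAll star S (allFin m)
    T₀-kept⇒S-kept : ∀ e → Kept T₀ e → Kept S e
    T₀-kept⇒S-kept e e∉T₀ e∈S = e∉T₀ (addAll-⊇ star (allFin m) e∈S)
    v-isolated : Isolated (ReachVia (Kept T₀)) v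
    v-isolated = no-edge⇒isolated λ e e∉T₀ inc →
      e∉T₀ (addAll-∋ star (allFin m) (∈-allFin e) (does-true (incidentKept? v e) (T₀-kept⇒S-kept e e∉T₀ , inc)))
    neighbour : src e ≡ v ⊎ dst e ≡ v → Σ (Fin k) λ u → u ≢ v × ReachVia (Kept S) v u
    neighbour (inj₁ s≡v) = dst e , (λ d≡v → no-loop e (trans s≡v (sym d≡v))) , (e , e∉S , inj₁ (s≡v , refl)) ◅ ε
    neighbour (inj₂ d≡v) = src e , (λ s≡v → no-loop e (trans s≡v (sym d≡v))) , (e , e∉S , inj₂ (refl , d≡v)) ◅ ε
    S-below : #components S N.≤ suc h
    S-below = subst (N._≤ suc h) (sym #S≡h) (ℕₚ.n≤1+n h)
    T₀-above : suc h N.≤ #components T₀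
    T₀-above = let (u , u≢v , v~u) = neighbour e-at-v in
      subst (λ c → suc c N.≤ #components T₀) #S≡h
        (classes-isolate (reach-mono T₀-kept⇒S-kept) v u u≢v v~u v-isolated (components T₀) (components S))
    weight-T₀ : weight G T₀ ≤ weight G S + degree v
    weight-T₀ = ≤-trans (weight-addAll star (allFin m) S)
      (≤-reflexive (cong (weight G S +_) (listWeight-tabulate star m (λ x → x))))

  -- If G − S has fewer than k components, some vertex is not isolated in
  -- G − S; take one of minimum degree among those.
  min-degree-vertex : #components S N.< k → Minimiser (Fin k) NonIsolated degree
  min-degree-vertex few with minimiser-Fin k NonIsolated nonIsolated? degree
  ... | inj₂ v = v
  ... | inj₁ none = ⊥-elim (ℕₚ.<⇒≱ few (classes-discrete (components S) (λ x → ¬nonIsolated⇒isolated (none x))))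

  -- Averaging: if G − S has h = a + 2 < k components, there are p ≥ 2
  -- non-isolated vertices with k ≤ p + (h − 1), each of degree at least the
  -- minimum d, so p·d ≤ Σ degrees ≤ 2·w(G − S).
  min-degree-bound : ∀ a → #components S ≡ suc (suc a) → suc (suc a) N.< k →
    ((v , _) : Minimiser (Fin k) NonIsolated degree) →
    Σ ℕ λ p′ → fromℕ (suc (suc p′)) * degree v ≤ restWeight S + restWeight S × k N.≤ suc (suc p′) N.+ suc a
  min-degree-bound a #S≡h h<k (v , v-non-isolated , v-minimal) = conclude
    (enough-non-isolated (countTrue k nonIso) (countTrue k iso) k a (countTrue-complement k nonIso)
      (ℕₚ.≤-pred (subst (suc (countTrue k iso) N.≤_) #S≡h isolated-count)) h<k)
    where
    open ≤-Reasoning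
    nonIso iso : Fin k → Bool
    nonIso u = does (nonIsolated? u)
    iso u = not (nonIso u)
    -- the isolated vertices and the component of v are distinct components
    isolated-count : suc (countTrue k iso) N.≤ #components S
    isolated-count = classes-isolated (components S) iso
      (λ x t → ¬nonIsolated⇒isolated (does-false (nonIsolated? x) t))
      v (λ t → does-false (nonIsolated? v) t v-non-isolated)
    at-least-min : ∀ u → when (nonIso u) (degree v) ≤ degree u
    at-least-min u with nonIsolated? u
    ... | yes u-non-isolated = v-minimal u u-non-isolated
    ... | no  _              = degree-nonneg u
    degree-sum : fromℕ (countTrue k nonIso) * degree v ≤ restWeight S + restWeight S
    degree-sum = begin
      fromℕ (countTrue k nonIso) * degree v        ≡⟨ sumF-countTrue k nonIso (degree v) ⟨
      sumF k (λ u → when (nonIso u) (degree v))    ≤⟨ sumF-mono k at-least-min ⟩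
      sumF k degree                                ≤⟨ handshake ⟩
      restWeight S + restWeight S                  ∎
    conclude : Σ ℕ (λ p′ → countTrue k nonIso ≡ suc (suc p′) × k N.≤ suc (suc p′) N.+ suc a) →
      Σ ℕ λ p′ → fromℕ (suc (suc p′)) * degree v ≤ restWeight S + restWeight S × k N.≤ suc (suc p′) N.+ suc a
    conclude (p′ , p≡p′+2 , k≤p+h-1) =
      p′ , subst (λ p → fromℕ p * degree v ≤ restWeight S + restWeight S) p≡p′+2 degree-sum , k≤p+h-1

lemma4 : (F : OrderedField) → let open OrderedField F in
    (k m : ℕ) (G : WGraph F k m) → Connected G → Normalized G →
    (δ : Carrier) → 0# ≤ δ →
    (h : ℕ) → 2 N.≤ h → h N.< k →
    (S : Subset m) → IsSplit G S h → density G S h ≤ ((1# + δ) /ℕ k) →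
    Σ (Subset m) λ T → IsMinSplit G T (N.suc h)
    × density G T (N.suc h) ≤ (((1# + δ) /ℕ k) + ((1# - δ) /ℕ (h N.* k)))
lemma4 F zero m G connected normalized δ δ≥0 h 2≤h () S S-split S-density
lemma4 F (suc k′) m G connected normalized δ δ≥0 h@(suc (suc a)) (N.s≤s (N.s≤s N.z≤n)) h<k S S-split S-density =
  let
      (v , v-non-isolated , v-minimal) = min-degree-vertex (subst (N._< suc k′) (sym #S≡h) h<k)
      (p′ , p·d≤2rest , k≤p+h-1) = min-degree-bound a #S≡h h<k (v , v-non-isolated , v-minimal)
      (T₁ , #T₁≡h+1 , weight-T₁) = star-split h v #S≡h v-non-isolated
      T₁-split = #components⇒split #T₁≡h+1
      (T , T-minimum) = minimum-split T₁-split
  in T , T-minimum ,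
     density-bound a k′ p′ (weight G S) (degree v) (restWeight S) (weight G T) δ δ≥0
       rest+S≡1 S-density p·d≤2rest k≤p+h-1 (≤-trans (proj₂ T-minimum T₁ T₁-split) weight-T₁)
  where
  open OrderedFieldFacts F
  open BoundArithmetic F
  open Reachability G
  open Splits connected zero
  open Weights G
  open Degrees G S
  #S≡h : #components S ≡ h
  #S≡h = split⇒#components S-split
  rest+S≡1 : restWeight S + weight G S ≡ 1#
  rest+S≡1 = trans (+-comm _ _) (trans (weight-complement S) normalized)
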